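{- Let $(U,\varphi)$ be a finite standard closure space, $x\in U$, and let $C=\varphi(B)$ for some $E$-generator $B$ of $x$. Then every $\varphi^b$-minimal spanning set $A$ of $C$ with $x\notin\varphi^b(A)$ is an $E$-generator of $x$.
   Context: $(U,\varphi)$: finite set with closure operator; standard: $\varphi(\{x\})\setminus\{x\}$ closed for all $x$. $\varphi^b(X)=\bigcup_{y\in X}\varphi(\{y\})$. A spanning set of a closed set $C$ is $X$ with $\varphi(X)=C$; it is $\varphi^b$-minimal if no $Y$ with $\varphi^b(Y)\subsetneq\varphi^b(X)$ spans $C$. $D$-generator of $x$: $A$ with $x\in\varphi(A)$, $x\notin\varphi^b(A)$, and $x\notin\varphi(Y)$ for all $Y$ with $\varphi^b(Y)\subsetneq\varphi^b(A)$. $E$-generator of $x$: a $D$-generator $A$ of $x$ with $\varphi(A)$ inclusion-minimal among closures of $D$-generators of $x$. -}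

module Defs where

open import Data.Nat using (ℕ)
open import Data.Bool using (if_then_else_)
open import Data.Fin using (Fin)
open import Data.Fin.Subset using (Subset; _∈_; _∉_; _⊆_; _⊂_; _─_; ⁅_⁆; ⊥; ⋃)
open import Data.Vec using (lookup)
open import Data.List as List using ()
open import Data.Product using (_×_)
open import Relation.Binary.PropositionalEquality using (_≡_)
open import Relation.Nullary using (¬_)

-- The ground set U is Fin n (an arbitrary finite set), subsets are
-- stdlib Subset n (= Vec Bool n).

record IsClosureOperator {n : ℕ} (φ : Subset n → Subset n) : Set where
  field
    extensive  : ∀ X → X ⊆ φ X
    monotone   : ∀ X Y → X ⊆ Y → φ X ⊆ φ Y
    idempotent : ∀ X → φ (φ X) ≡ φ X

Closed : {n : ℕ} → (Subset n → Subset n) → Subset n → Set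
Closed φ X = φ X ≡ X

Standard : {n : ℕ} → (Subset n → Subset n) → Set
Standard {n} φ = ∀ (x : Fin n) → Closed φ (φ ⁅ x ⁆ ─ ⁅ x ⁆)

-- φ^b(X) = ⋃_{y ∈ X} φ({y})
φb : {n : ℕ} → (Subset n → Subset n) → Subset n → Subset n
φb {n} φ X = ⋃ (List.map (λ y → if lookup X y then φ ⁅ y ⁆ else ⊥) (List.allFin n))

BMinimalSpanning : {n : ℕ} → (Subset n → Subset n) → Subset n → Subset n → Set
BMinimalSpanning φ C A =
  (φ A ≡ C) × (∀ Y → φb φ Y ⊂ φb φ A → ¬ (φ Y ≡ C))

DGenerator : {n : ℕ} → (Subset n → Subset n) → Fin n → Subset n → Set
DGenerator φ x A =
  (x ∈ φ A) × (x ∉ φb φ A) × (∀ Y → φb φ Y ⊂ φb φ A → x ∉ φ Y)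

EGenerator : {n : ℕ} → (Subset n → Subset n) → Fin n → Subset n → Set
EGenerator φ x A =
  DGenerator φ x A × (∀ A′ → DGenerator φ x A′ → ¬ (φ A′ ⊂ φ A))

{-# OPTIONS --safe #-}
-- A is a D-generator of x by well-founded induction on φᵇ Y: a set Y with
-- φᵇ(Y) ⊂ φᵇ(A) and x ∈ φ(Y) has φ(Y) ⊆ φ(A) = φ(B).  Equality would make Y a
-- spanning set of C below A, contradicting φᵇ-minimality of A; strict
-- inclusion would make Y (a D-generator, by the induction hypothesis) beat the
-- E-generator B.  Minimality of φ(A) = φ(B) is then inherited from B.
module Submission where

open import Defs
open import Data.Nat using (ℕ)
open import Data.Bool using (true; false; if_then_else_)
open import Data.Fin using (Fin)
open import Data.Fin.Subset
open import Data.Fin.Subset.Properties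
open import Data.Fin.Subset.Induction using (⊂-wellFounded)
open import Data.Vec using (lookup)
open import Data.Vec.Properties using ([]=⇒lookup; lookup⇒[]=)
open import Data.List as List using ([]; _∷_)
import Data.List.Membership.Propositional as List
open import Data.List.Membership.Propositional.Properties using (∈-allFin)
open import Data.List.Relation.Unary.Any using (here; there)
open import Data.Product using (_,_; proj₁; proj₂; ∃)
open import Data.Sum using (inj₁; inj₂)
open import Relation.Binary.PropositionalEquality
open import Relation.Nullary using (¬_; yes; no)
open import Relation.Nullary.Negation using (contradiction)
open import Induction.WellFounded using (Acc; acc; WellFounded)
import Relation.Binary.Construct.On as On

module _ {n : ℕ} {A : Set} (f : A → Subset n) where

  ∈-⋃-map⁻ : ∀ xs {z} → z ∈ ⋃ (List.map f xs) → ∃ λ y → z ∈ f y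
  ∈-⋃-map⁻ []       z∈ = contradiction z∈ ∉⊥
  ∈-⋃-map⁻ (x ∷ xs) z∈ with x∈p∪q⁻ (f x) (⋃ (List.map f xs)) z∈
  ... | inj₁ z∈fx = x , z∈fx
  ... | inj₂ z∈⋃  = ∈-⋃-map⁻ xs z∈⋃

  ∈-⋃-map⁺ : ∀ xs {y z} → y List.∈ xs → z ∈ f y → z ∈ ⋃ (List.map f xs)
  ∈-⋃-map⁺ (x ∷ xs) (here refl) z∈fy = x∈p∪q⁺ (inj₁ z∈fy)
  ∈-⋃-map⁺ (x ∷ xs) (there y∈)  z∈fy = x∈p∪q⁺ {p = f x} (inj₂ (∈-⋃-map⁺ xs y∈ z∈fy))

⊆∧⊄⇒≡ : ∀ {n} {p q : Subset n} → p ⊆ q → ¬ (p ⊂ q) → p ≡ q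
⊆∧⊄⇒≡ {p = p} p⊆q p⊄q = ⊆-antisym p⊆q q⊆p
  where
  q⊆p : _ ⊆ p
  q⊆p {x} x∈q with x ∈? p
  ... | yes x∈p = x∈p
  ... | no  x∉p = contradiction ((λ {_} → p⊆q) , x , x∈q , x∉p) p⊄q

module _ {n : ℕ} {φ : Subset n → Subset n} (closure : IsClosureOperator φ) where
  open IsClosureOperator closure

  ⊆-φb : ∀ X → X ⊆ φb φ X
  ⊆-φb X {y} y∈X = ∈-⋃-map⁺ _ (List.allFin n) (∈-allFin y) y∈φby
    where
    y∈φby : y ∈ (if lookup X y then φ ⁅ y ⁆ else ⊥)
    y∈φby rewrite []=⇒lookup y∈X = extensive ⁅ y ⁆ (x∈⁅x⁆ y)

  φb-⊆-φ : ∀ X → φb φ X ⊆ φ X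
  φb-⊆-φ X z∈ with ∈-⋃-map⁻ _ (List.allFin n) z∈
  ... | y , z∈φby with lookup X y in y∈X
  ... | true  = monotone ⁅ y ⁆ X ⁅y⁆⊆X z∈φby
    where
    ⁅y⁆⊆X : ⁅ y ⁆ ⊆ X
    ⁅y⁆⊆X w∈⁅y⁆ rewrite x∈⁅y⁆⇒x≡y y w∈⁅y⁆ = lookup⇒[]= y X y∈X
  ... | false = contradiction z∈φby ∉⊥

  φ-φb≡φ : ∀ X → φ (φb φ X) ≡ φ X
  φ-φb≡φ X = ⊆-antisym
    (subst (φ (φb φ X) ⊆_) (idempotent X) (monotone _ _ (φb-⊆-φ X)))
    (monotone _ _ (⊆-φb X))

  φb-⊆⇒φ-⊆ : ∀ {X Y} → φb φ X ⊆ φb φ Y → φ X ⊆ φ Y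
  φb-⊆⇒φ-⊆ {X} {Y} φbX⊆φbY =
    subst₂ _⊆_ (φ-φb≡φ X) (φ-φb≡φ Y) (monotone _ _ φbX⊆φbY)

  module _ {x : Fin n} {A B : Subset n}
           (B-gen : EGenerator φ x B) (A-spans : BMinimalSpanning φ (φ B) A)
           (x∉φbA : x ∉ φb φ A) where

    private
      _<ᵇ_ : Subset n → Subset n → Set
      Y <ᵇ Z = φb φ Y ⊂ φb φ Z

      <ᵇ-wellFounded : WellFounded _<ᵇ_
      <ᵇ-wellFounded = On.wellFounded (φb φ) ⊂-wellFounded

    ∉-φ-below-minimal-spanning : ∀ Y → φb φ Y ⊂ φb φ A → x ∉ φ Y
    ∉-φ-below-minimal-spanning Y = go Y (<ᵇ-wellFounded Y)
      where
      go : ∀ Y → Acc _<ᵇ_ Y → Y <ᵇ A → x ∉ φ Y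
      go Y (acc rec) Y<A x∈φY with φ Y ⊂? φ B
      ... | yes φY⊂φB = proj₂ B-gen Y Y-gen φY⊂φB
        where
        Y-gen : DGenerator φ x Y
        Y-gen = x∈φY , (λ x∈φbY → x∉φbA (proj₁ Y<A x∈φbY))
              , λ Z Z<Y → go Z (rec Z<Y) (⊂-trans Z<Y Y<A)
      ... | no  φY⊄φB = proj₂ A-spans Y Y<A (⊆∧⊄⇒≡ φY⊆φB φY⊄φB)
        where
        φY⊆φB : φ Y ⊆ φ B
        φY⊆φB = subst (φ Y ⊆_) (proj₁ A-spans) (φb-⊆⇒φ-⊆ (proj₁ Y<A))

    DGenerator-of-minimal-spanning : DGenerator φ x A
    DGenerator-of-minimal-spanning =
      subst (x ∈_) (sym (proj₁ A-spans)) (proj₁ (proj₁ B-gen)) , x∉φbA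
      , ∉-φ-below-minimal-spanning

EGenerator-resp-φ : ∀ {n} {φ : Subset n → Subset n} {x A B} →
  EGenerator φ x B → DGenerator φ x A → φ A ≡ φ B → EGenerator φ x A
EGenerator-resp-φ {φ = φ} (_ , B-min) A-gen φA≡φB =
  A-gen , λ A′ A′-gen φA′⊂φA → B-min A′ A′-gen (subst (φ A′ ⊂_) φA≡φB φA′⊂φA)

corollary2 : (n : ℕ) (φ : Subset n → Subset n) → IsClosureOperator φ → Standard φ →
    (x : Fin n) (B : Subset n) → EGenerator φ x B →
    (A : Subset n) → BMinimalSpanning φ (φ B) A → x ∉ φb φ A →
    EGenerator φ x A
corollary2 n φ closure _ x B B-gen A A-spans x∉φbA =
  EGenerator-resp-φ B-gen
    (DGenerator-of-minimal-spanning closure B-gen A-spans x∉φbA)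
    (proj₁ A-spans)
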